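{- Let $\mathcal{E}$ be a set of equations and $\mathcal{R}$ a set of rewrite rules over the terms described in the context, with $\sim$, $\to_{\mathcal{R}}$, $\rhd\!\!\!\!\rhd$ as defined there. Assume: (1) $\mathcal{E}$ is linear; (2) $\mathcal{R}$ is left-linear: in every rule $l\to r\in\mathcal{R}$, no variable occurs more than once in $l$; (3) $\to_{\mathcal{R}}$ is $\sim$-confluent on $\sim$-classes: for all $t,t',u,v$ with $t\to_{\mathcal{R}}^*u$, $t\sim t'$ and $t'\to_{\mathcal{R}}^*v$, there exist $u',v'$ with $u\to_{\mathcal{R}}^*u'$, $v\to_{\mathcal{R}}^*v'$ and $u'\sim v'$. Then $\rhd\!\!\!\!\rhd$ is $\sim$-confluent on $\sim$-classes: for all $t,t',u,v$ with $t\rhd\!\!\!\!\rhd^*u$, $t\sim t'$ and $t'\rhd\!\!\!\!\rhd^*v$, there exist $u',v'$ with $u\rhd\!\!\!\!\rhd^*u'$, $v\rhd\!\!\!\!\rhd^*v'$ and $u'\sim v'$.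
   Context: Terms (considered modulo renaming of bound variables): $t,u ::= s \mid x \mid f \mid [x:t]u \mid tu \mid (x:t)u$, where $s\in\{\star,\Box\}$ is a sort, $x$ ranges over an infinite set of variables, $f$ ranges over a set $\mathcal{F}$ of symbols, $[x:t]u$ is an abstraction (binding $x$ in $u$), $tu$ an application and $(x:t)u$ a dependent product (binding $x$ in $u$). Every symbol $f$ has an arity $\alpha_f\in\mathbb{N}$. A term is algebraic if it is built only from variables and applications $f t_1\ldots t_n$ with $n=\alpha_f$. $\mathrm{FV}(t)$ is the set of free variables of $t$; $t|_p$ is the subterm at position $p$ and $t[u]_p$ the replacement of $t|_p$ by $u$. A rewrite rule is a pair $l\to r$ of terms with $l$ algebraic, $l$ not a variable, and $\mathrm{FV}(r)\subseteq\mathrm{FV}(l)$. For a set of rules $\mathcal{R}$, $t\to_{\mathcal{R}} t'$ iff there are a position $p$, a rule $l\to r\in\mathcal{R}$ and a substitution $\sigma$ with $t|_p=l\sigma$ and $t'=t[r\sigma]_p$. $t\to_\beta t'$ iff there is a position $p$ with $t|_p=([x:U]v)\,u$ and $t'=t[v\{x\mapsto u\}]_p$. A set of equations $\mathcal{E}$ is a set of rewrite rules that is symmetric ($l\to r\in\mathcal{E}$ iff $r\to l\in\mathcal{E}$), such that for each $l\to r\in\mathcal{E}$ both $l$ and $r$ are algebraic, headed by a symbol, and $\mathrm{FV}(l)=\mathrm{FV}(r)$. $\mathcal{E}$ is linear if in every rule of $\mathcal{E}$ no variable occurs more than once in the left-hand side and no variable occurs more than once in the right-hand side. $\sim$ is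 the reflexive and transitive closure of $\to_{\mathcal{E}}$. $t\rhd\!\!\!\!\rhd u$ iff $t\to_\beta u$, or there exists $t'$ with $t\sim t'$ and $t'\to_{\mathcal{R}} u$. $S^*$ is the reflexive and transitive closure of a relation $S$. -}

module Defs where

open import Data.Nat using (ℕ; zero; suc; _+_; _≤_)
open import Data.Product using (Σ; ∃; ∃-syntax; _×_; _,_)
open import Data.Sum using (_⊎_)
open import Data.Empty using (⊥)
open import Relation.Nullary using (¬_)
open import Relation.Binary.PropositionalEquality using (_≡_)
open import Relation.Binary.Construct.Closure.ReflexiveTransitive using (Star)

-- Terms modulo α-renaming are represented with de Bruijn indices.
data Sort : Set where
  star box : Sort

data Term (F : Set) : Set where
  srt  : Sort → Term F
  var  : ℕ → Term F
  sym  : F → Term F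
  abs  : Term F → Term F → Term F        -- [x:t]u  (binds index 0 in u)
  app  : Term F → Term F → Term F
  prod : Term F → Term F → Term F        -- (x:t)u  (binds index 0 in u)

Rel : Set → Set₁
Rel A = A → A → Set

module _ {F : Set} where

  ext : (ℕ → ℕ) → ℕ → ℕ
  ext ρ zero    = zero
  ext ρ (suc n) = suc (ρ n)

  rename : (ℕ → ℕ) → Term F → Term F
  rename ρ (srt s)    = srt s
  rename ρ (var x)    = var (ρ x)
  rename ρ (sym f)    = sym f
  rename ρ (abs t u)  = abs (rename ρ t) (rename (ext ρ) u)
  rename ρ (app t u)  = app (rename ρ t) (rename ρ u)
  rename ρ (prod t u) = prod (rename ρ t) (rename (ext ρ) u)

  exts : (ℕ → Term F) → ℕ → Term F
  exts σ zero    = var zero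
  exts σ (suc n) = rename suc (σ n)

  subst : (ℕ → Term F) → Term F → Term F
  subst σ (srt s)    = srt s
  subst σ (var x)    = σ x
  subst σ (sym f)    = sym f
  subst σ (abs t u)  = abs (subst σ t) (subst (exts σ) u)
  subst σ (app t u)  = app (subst σ t) (subst σ u)
  subst σ (prod t u) = prod (subst σ t) (subst (exts σ) u)

  -- v{x ↦ u} where x is the variable bound by the enclosing binder (index 0)
  subst₀ : Term F → ℕ → Term F
  subst₀ u zero    = u
  subst₀ u (suc n) = var n

  _[_] : Term F → Term F → Term F
  v [ u ] = subst (subst₀ u) v

  data _∈FV_ : ℕ → Term F → Set where
    here  : ∀ {x} → x ∈FV var x
    absL  : ∀ {x t u} → x ∈FV t → x ∈FV abs t u
    absR  : ∀ {x t u} → suc x ∈FV u → x ∈FV abs t u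
    appL  : ∀ {x t u} → x ∈FV t → x ∈FV app t u
    appR  : ∀ {x t u} → x ∈FV u → x ∈FV app t u
    prodL : ∀ {x t u} → x ∈FV t → x ∈FV prod t u
    prodR : ∀ {x t u} → suc x ∈FV u → x ∈FV prod t u

  occ : ℕ → Term F → ℕ
  occ x (srt s)    = 0
  occ x (var y) with x Data.Nat.≟ y
  ... | Relation.Nullary.yes _ = 1
  ... | Relation.Nullary.no  _ = 0
  occ x (sym f)    = 0
  occ x (abs t u)  = occ x t + occ (suc x) u
  occ x (app t u)  = occ x t + occ x u
  occ x (prod t u) = occ x t + occ (suc x) u

  LinearTerm : Term F → Set
  LinearTerm t = ∀ x → occ x t ≤ 1

  head : Term F → Term F
  head (app t u) = head t
  head t         = t

  HeadedBySymbol : Term F → Set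
  HeadedBySymbol t = ∃[ f ] head t ≡ sym f

  IsVar : Term F → Set
  IsVar t = ∃[ x ] t ≡ var x

  mutual
    data Algebraic (α : F → ℕ) : Term F → Set where
      var : ∀ x → Algebraic α (var x)
      fun : ∀ {f t} → AlgSpine α f t (α f) → Algebraic α t

    -- AlgSpine α f t n : t = f u₁ … uₙ with all uᵢ algebraic
    data AlgSpine (α : F → ℕ) (f : F) : Term F → ℕ → Set where
      sym : AlgSpine α f (sym f) 0
      app : ∀ {h u n} → AlgSpine α f h n → Algebraic α u → AlgSpine α f (app h u) (suc n)

  -- rewrite rules (a set of rules is a relation l → r)
  IsRuleSet : (α : F → ℕ) → Rel (Term F) → Set
  IsRuleSet α R = ∀ {l r} → R l r →
    Algebraic α l × ¬ IsVar l × (∀ x → x ∈FV r → x ∈FV l)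

  IsEquationSet : (α : F → ℕ) → Rel (Term F) → Set
  IsEquationSet α E =
    (∀ {l r} → E l r → E r l) ×
    (∀ {l r} → E l r →
       Algebraic α l × Algebraic α r × HeadedBySymbol l × HeadedBySymbol r ×
       (∀ x → (x ∈FV l → x ∈FV r) × (x ∈FV r → x ∈FV l)))

  LinearEqs : Rel (Term F) → Set
  LinearEqs E = ∀ {l r} → E l r → LinearTerm l × LinearTerm r

  LeftLinear : Rel (Term F) → Set
  LeftLinear R = ∀ {l r} → R l r → LinearTerm l

  data Ctx (S : Rel (Term F)) : Rel (Term F) where
    root  : ∀ {t u} → S t u → Ctx S t u
    absL  : ∀ {t t' u} → Ctx S t t' → Ctx S (abs t u) (abs t' u)
    absR  : ∀ {t u u'} → Ctx S u u' → Ctx S (abs t u) (abs t u')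
    appL  : ∀ {t t' u} → Ctx S t t' → Ctx S (app t u) (app t' u)
    appR  : ∀ {t u u'} → Ctx S u u' → Ctx S (app t u) (app t u')
    prodL : ∀ {t t' u} → Ctx S t t' → Ctx S (prod t u) (prod t' u)
    prodR : ∀ {t u u'} → Ctx S u u' → Ctx S (prod t u) (prod t u')

  data RootStep (R : Rel (Term F)) : Rel (Term F) where
    inst : ∀ {l r} (σ : ℕ → Term F) → R l r → RootStep R (subst σ l) (subst σ r)

  RStep : Rel (Term F) → Rel (Term F)
  RStep R = Ctx (RootStep R)

  data BetaRoot : Rel (Term F) where
    beta : ∀ U v u → BetaRoot (app (abs U v) u) (v [ u ])

  BetaStep : Rel (Term F)
  BetaStep = Ctx BetaRoot

  Equiv : Rel (Term F) → Rel (Term F)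
  Equiv E = Star (RStep E)

  BigStep : Rel (Term F) → Rel (Term F) → Rel (Term F)
  BigStep E R t u = BetaStep t u ⊎ (∃[ t' ] Equiv E t t' × RStep R t' u)

  ConfluentModulo : Rel (Term F) → Rel (Term F) → Set
  ConfluentModulo E S = ∀ {t t' u v} →
    Star S t u → Equiv E t t' → Star S t' v →
    ∃[ u' ] ∃[ v' ] (Star S u u' × Star S v v' × Equiv E u' v')

-- Parallel β-reduction ⇛ has the diamond property (Takahashi: every ⇛-reduct of t
-- reduces in parallel to the complete development of t).  Since the left-hand sides
-- of E and R are linear algebraic terms headed by a symbol, a ⇛-step out of an
-- instance lσ only reduces inside σ and ends in an instance lσ' with σ ⇛ σ'; hence
-- ⇛ commutes with ∼ and with →R*.  Together with the ∼-confluence of →R this makes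
-- ∼ ; (⇛ ∪ →R*) diamond modulo ∼, so its reflexive-transitive closure is confluent
-- modulo ∼ by the strip argument.  That closure agrees with ▷▷* up to a trailing ∼,
-- because ∼ can be postponed past ▷▷-steps (again by commuting ∼ with ⇛).

module Submission where

open import Data.Nat using (ℕ; zero; suc; _+_; _≤_; _≟_; s≤s)
open import Data.Nat.Properties using (m+n≡0⇒m≡0; m+n≡0⇒n≡0; n≤0⇒n≡0; m≤m+n; m≤n+m; ≤-trans)
open import Data.Product using (∃-syntax; _×_; _,_; proj₁)
open import Data.Sum using (inj₁; inj₂)
open import Data.Empty using (⊥-elim)
open import Function using (_∘_)
open import Relation.Nullary using (¬_; yes; no)
open import Relation.Binary.Core using (_⇒_)
open import Relation.Binary.Structures using (IsEquivalence)
open import Relation.Binary.Construct.Union using (_∪_)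
open import Relation.Binary.Construct.Closure.ReflexiveTransitive
  using (Star; ε; _◅_; _◅◅_; gmap; map; reverse; return)
open import Relation.Binary.PropositionalEquality as ≡
  using (_≡_; _≢_; _≗_; refl; cong; cong₂)

open import Defs

-- The relational composition _;_ of Relation.Binary.Construct.Composition cannot be
-- written in source code: ';' is lexed as a layout separator.
infixr 9 _⨾_
_⨾_ : ∀ {A : Set} → Rel A → Rel A → Rel A
(L ⨾ R) t v = ∃[ u ] (L t u × R u v)

-- Confluence modulo an equivalence

module ModuloEquivalence {A : Set} {_∼_ : Rel A} (∼-isEquivalence : IsEquivalence _∼_) where

  open IsEquivalence ∼-isEquivalence public
    renaming (refl to ∼-refl; sym to ∼-sym; trans to ∼-trans)

  Joinable : Rel A → Rel A
  Joinable S u v = ∃[ u' ] ∃[ v' ] (S u u' × S v v' × u' ∼ v')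

  ConfluentMod : Rel A → Set
  ConfluentMod S = ∀ {t t' u v} →
    Star S t u → t ∼ t' → Star S t' v → Joinable (Star S) u v

  DiamondMod : Rel A → Set
  DiamondMod U = ∀ {t t' u v} →
    U t u → t ∼ t' → U t' v → Joinable (_∼_ ⨾ U) u v

  joinable-sym : ∀ {S u v} → Joinable S u v → Joinable S v u
  joinable-sym (u' , v' , uu' , vv' , u'∼v') = v' , u' , vv' , uu' , ∼-sym u'∼v'

  module _ {U : Rel A} where

    private
      T : Rel A
      T = _∼_ ⨾ U

    ∼⨾T*⊆T*⨾∼ : (_∼_ ⨾ Star T) ⇒ (Star T ⨾ _∼_)
    ∼⨾T*⊆T*⨾∼ (_ , t∼s , ε)                    = _ , ε , t∼s
    ∼⨾T*⊆T*⨾∼ (_ , t∼s , (_ , s∼s' , u) ◅ us) = _ , (_ , ∼-trans t∼s s∼s' , u) ◅ us , ∼-refl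

    joinable-∼ʳ : ∀ {u v v'} → v ∼ v' → Joinable (Star T) u v' → Joinable (Star T) u v
    joinable-∼ʳ v∼v' (a , b , ua , v'b , a∼b) with ∼⨾T*⊆T*⨾∼ (_ , v∼v' , v'b)
    ... | b₀ , vb₀ , b₀∼b = a , b₀ , ua , vb₀ , ∼-trans a∼b (∼-sym b₀∼b)

    module _ (diamond : DiamondMod U) where

      T-diamond : ∀ {t u v} → T t u → T t v → Joinable T u v
      T-diamond (_ , t∼s , su) (_ , t∼s' , s'v) = diamond su (∼-trans (∼-sym t∼s) t∼s') s'v

      strip : ∀ {t u v} → T t u → Star T t v → Joinable (Star T) u v
      strip tu ε = _ , _ , ε , return tu , ∼-refl
      strip tu (tv₁ ◅ v₁v) with T-diamond tu tv₁
      ... | w₁ , w₁' , uw₁ , v₁w₁' , w₁∼w₁' with joinable-∼ʳ w₁∼w₁' (joinable-sym {Star T} (strip v₁w₁' v₁v))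
      ... | a , b , va , w₁b , a∼b = b , a , uw₁ ◅ w₁b , va , ∼-sym a∼b

      star-confluent : ∀ {t u v} → Star T t u → Star T t v → Joinable (Star T) u v
      star-confluent ε tv = _ , _ , tv , ε , ∼-refl
      star-confluent (tu₁ ◅ u₁u) tv with strip tu₁ tv
      ... | w₁ , w₁' , u₁w₁ , vw₁' , w₁∼w₁' with joinable-∼ʳ (∼-sym w₁∼w₁') (star-confluent u₁u u₁w₁)
      ... | a , b , ua , w₁'b , a∼b = a , b , ua , vw₁' ◅◅ w₁'b , a∼b

      diamondMod⇒confluentMod : ConfluentMod T
      diamondMod⇒confluentMod tu t∼t' t'v with ∼⨾T*⊆T*⨾∼ (_ , t∼t' , t'v)
      ... | v₀ , tv₀ , v₀∼v = joinable-∼ʳ (∼-sym v₀∼v) (star-confluent tu tv₀)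

  module _ {S T : Rel A}
           (S⊆T : S ⇒ T) (T⊆∼⨾S* : T ⇒ (_∼_ ⨾ Star S))
           (postpone : ∀ {t s v} → t ∼ s → Star S s v → (Star S ⨾ _∼_) t v) where

    T*⊆S*⨾∼ : Star T ⇒ (Star S ⨾ _∼_)
    T*⊆S*⨾∼ ε = _ , ε , ∼-refl
    T*⊆S*⨾∼ (tm ◅ mu) with T⊆∼⨾S* tm | T*⊆S*⨾∼ mu
    ... | a , t∼a , am | b , mb , b∼u with postpone t∼a (am ◅◅ mb)
    ... | c , tc , c∼b = c , tc , ∼-trans c∼b b∼u

    confluentMod-transfer : ConfluentMod T → ConfluentMod S
    confluentMod-transfer T-confluent tu t∼t' t'v
      with T-confluent (map S⊆T tu) t∼t' (map S⊆T t'v)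
    ... | u' , v' , uu' , vv' , u'∼v' with T*⊆S*⨾∼ uu' | T*⊆S*⨾∼ vv'
    ... | u'' , uu'' , u''∼u' | v'' , vv'' , v''∼v' =
      u'' , v'' , uu'' , vv'' , ∼-trans u''∼u' (∼-trans u'∼v' (∼-sym v''∼v'))

m≢0⇒m+n≢0 : ∀ {m} n → m ≢ 0 → m + n ≢ 0
m≢0⇒m+n≢0 n m≢0 = m≢0 ∘ m+n≡0⇒m≡0 _

n≢0⇒m+n≢0 : ∀ m {n} → n ≢ 0 → m + n ≢ 0
n≢0⇒m+n≢0 m n≢0 = n≢0 ∘ m+n≡0⇒n≡0 m

m+n≤1∧n≢0⇒m≡0 : ∀ m {n} → m + n ≤ 1 → n ≢ 0 → m ≡ 0
m+n≤1∧n≢0⇒m≡0 zero    _         _   = refl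
m+n≤1∧n≢0⇒m≡0 (suc m) (s≤s m+n≤0) n≢0 = ⊥-elim (n≢0 (m+n≡0⇒n≡0 m (n≤0⇒n≡0 m+n≤0)))

module _ {F : Set} where

  private
    variable
      t t' u u' v a a' b b' U : Term F
      σ σ' τ : ℕ → Term F
      ρ : ℕ → ℕ

  open ≡.≡-Reasoning

  -- Substitution calculus

  ⇑ : (ℕ → ℕ) → ℕ → ℕ
  ⇑ = ext {F}

  exts-cong : σ ≗ τ → exts σ ≗ exts τ
  exts-cong h zero    = refl
  exts-cong h (suc n) = cong (rename suc) (h n)

  subst-cong : σ ≗ τ → subst σ ≗ subst τ
  subst-cong h (srt s)    = refl
  subst-cong h (var x)    = h x
  subst-cong h (sym f)    = refl
  subst-cong h (abs t u)  = cong₂ abs (subst-cong h t) (subst-cong (exts-cong h) u)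
  subst-cong h (app t u)  = cong₂ app (subst-cong h t) (subst-cong h u)
  subst-cong h (prod t u) = cong₂ prod (subst-cong h t) (subst-cong (exts-cong h) u)

  ids : ℕ → Term F
  ids = var

  ren : (ℕ → ℕ) → ℕ → Term F
  ren ρ = ids ∘ ρ

  exts-ren : ∀ ρ → exts (ren ρ) ≗ ren (⇑ ρ)
  exts-ren ρ zero    = refl
  exts-ren ρ (suc n) = refl

  rename-as-subst : ∀ ρ → rename ρ ≗ subst (ren ρ)
  rename-as-subst ρ (srt s)    = refl
  rename-as-subst ρ (var x)    = refl
  rename-as-subst ρ (sym f)    = refl
  rename-as-subst ρ (abs t u)  = cong₂ abs (rename-as-subst ρ t)
    (≡.trans (rename-as-subst (⇑ ρ) u) (≡.sym (subst-cong (exts-ren ρ) u)))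
  rename-as-subst ρ (app t u)  = cong₂ app (rename-as-subst ρ t) (rename-as-subst ρ u)
  rename-as-subst ρ (prod t u) = cong₂ prod (rename-as-subst ρ t)
    (≡.trans (rename-as-subst (⇑ ρ) u) (≡.sym (subst-cong (exts-ren ρ) u)))

  exts∘ext : ∀ (σ : ℕ → Term F) ρ → exts σ ∘ ⇑ ρ ≗ exts (σ ∘ ρ)
  exts∘ext σ ρ zero    = refl
  exts∘ext σ ρ (suc n) = refl

  subst-rename : ∀ (σ : ℕ → Term F) ρ → subst σ ∘ rename ρ ≗ subst (σ ∘ ρ)
  subst-rename σ ρ (srt s)    = refl
  subst-rename σ ρ (var x)    = refl
  subst-rename σ ρ (sym f)    = refl
  subst-rename σ ρ (abs t u)  = cong₂ abs (subst-rename σ ρ t)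
    (≡.trans (subst-rename (exts σ) (⇑ ρ) u) (subst-cong (exts∘ext σ ρ) u))
  subst-rename σ ρ (app t u)  = cong₂ app (subst-rename σ ρ t) (subst-rename σ ρ u)
  subst-rename σ ρ (prod t u) = cong₂ prod (subst-rename σ ρ t)
    (≡.trans (subst-rename (exts σ) (⇑ ρ) u) (subst-cong (exts∘ext σ ρ) u))

  rename-⇑-suc : ∀ ρ → rename (⇑ ρ) ∘ rename suc ≗ rename suc ∘ rename ρ
  rename-⇑-suc ρ t = begin
    rename (⇑ ρ) (rename suc t)    ≡⟨ rename-as-subst (⇑ ρ) (rename suc t) ⟩
    subst (ren (⇑ ρ)) (rename suc t) ≡⟨ subst-rename (ren (⇑ ρ)) suc t ⟩
    subst (ren (suc ∘ ρ)) t          ≡⟨ subst-rename (ren suc) ρ t ⟨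
    subst (ren suc) (rename ρ t)   ≡⟨ rename-as-subst suc (rename ρ t) ⟨
    rename suc (rename ρ t)          ∎

  rename∘exts : ∀ ρ (σ : ℕ → Term F) → rename (⇑ ρ) ∘ exts σ ≗ exts (rename ρ ∘ σ)
  rename∘exts ρ σ zero    = refl
  rename∘exts ρ σ (suc n) = rename-⇑-suc ρ (σ n)

  rename-subst : ∀ ρ (σ : ℕ → Term F) → rename ρ ∘ subst σ ≗ subst (rename ρ ∘ σ)
  rename-subst ρ σ (srt s)    = refl
  rename-subst ρ σ (var x)    = refl
  rename-subst ρ σ (sym f)    = refl
  rename-subst ρ σ (abs t u)  = cong₂ abs (rename-subst ρ σ t)
    (≡.trans (rename-subst (⇑ ρ) (exts σ) u) (subst-cong (rename∘exts ρ σ) u))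
  rename-subst ρ σ (app t u)  = cong₂ app (rename-subst ρ σ t) (rename-subst ρ σ u)
  rename-subst ρ σ (prod t u) = cong₂ prod (rename-subst ρ σ t)
    (≡.trans (rename-subst (⇑ ρ) (exts σ) u) (subst-cong (rename∘exts ρ σ) u))

  subst∘exts : ∀ (τ σ : ℕ → Term F) → subst (exts τ) ∘ exts σ ≗ exts (subst τ ∘ σ)
  subst∘exts τ σ zero    = refl
  subst∘exts τ σ (suc n) =
    ≡.trans (subst-rename (exts τ) suc (σ n)) (≡.sym (rename-subst suc τ (σ n)))

  subst-subst : ∀ (τ σ : ℕ → Term F) → subst τ ∘ subst σ ≗ subst (subst τ ∘ σ)
  subst-subst τ σ (srt s)    = refl
  subst-subst τ σ (var x)    = refl
  subst-subst τ σ (sym f)    = refl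
  subst-subst τ σ (abs t u)  = cong₂ abs (subst-subst τ σ t)
    (≡.trans (subst-subst (exts τ) (exts σ) u) (subst-cong (subst∘exts τ σ) u))
  subst-subst τ σ (app t u)  = cong₂ app (subst-subst τ σ t) (subst-subst τ σ u)
  subst-subst τ σ (prod t u) = cong₂ prod (subst-subst τ σ t)
    (≡.trans (subst-subst (exts τ) (exts σ) u) (subst-cong (subst∘exts τ σ) u))

  exts-ids : exts ids ≗ ids
  exts-ids zero    = refl
  exts-ids (suc n) = refl

  subst-ids : ∀ (t : Term F) → subst ids t ≡ t
  subst-ids (srt s)    = refl
  subst-ids (var x)    = refl
  subst-ids (sym f)    = refl
  subst-ids (abs t u)  = cong₂ abs (subst-ids t) (≡.trans (subst-cong exts-ids u) (subst-ids u))
  subst-ids (app t u)  = cong₂ app (subst-ids t) (subst-ids u)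
  subst-ids (prod t u) = cong₂ prod (subst-ids t) (≡.trans (subst-cong exts-ids u) (subst-ids u))

  subst-[] : ∀ (σ : ℕ → Term F) (b a : Term F) → subst σ (b [ a ]) ≡ subst (exts σ) b [ subst σ a ]
  subst-[] σ b a = begin
    subst σ (subst (subst₀ a) b)                    ≡⟨ subst-subst σ (subst₀ a) b ⟩
    subst (subst σ ∘ subst₀ a) b                    ≡⟨ subst-cong pointwise b ⟩
    subst (subst (subst₀ (subst σ a)) ∘ exts σ) b   ≡⟨ subst-subst _ (exts σ) b ⟨
    subst (subst₀ (subst σ a)) (subst (exts σ) b)   ∎
    where
    pointwise : subst σ ∘ subst₀ a ≗ subst (subst₀ (subst σ a)) ∘ exts σ
    pointwise zero    = refl
    pointwise (suc n) = ≡.sym (≡.trans (subst-rename _ suc (σ n)) (subst-ids (σ n)))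

  rename-[] : ∀ ρ (b a : Term F) → rename ρ (b [ a ]) ≡ rename (⇑ ρ) b [ rename ρ a ]
  rename-[] ρ b a = begin
    rename ρ (b [ a ])                              ≡⟨ rename-as-subst ρ (b [ a ]) ⟩
    subst (ren ρ) (b [ a ])                       ≡⟨ subst-[] (ren ρ) b a ⟩
    subst (exts (ren ρ)) b [ subst (ren ρ) a ]  ≡⟨ cong₂ _[_] renamed-body renamed-arg ⟨
    rename (⇑ ρ) b [ rename ρ a ]                 ∎
    where
    renamed-body : rename (⇑ ρ) b ≡ subst (exts (ren ρ)) b
    renamed-body = ≡.trans (rename-as-subst (⇑ ρ) b) (≡.sym (subst-cong (exts-ren ρ) b))
    renamed-arg : rename ρ a ≡ subst (ren ρ) a
    renamed-arg = rename-as-subst ρ a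

  -- Parallel β-reduction

  infix 4 _⇛_ _⇛ₛ_

  data _⇛_ : Rel (Term F) where
    srt  : ∀ {s} → srt s ⇛ srt s
    var  : ∀ {x} → var x ⇛ var x
    sym  : ∀ {f} → sym f ⇛ sym f
    abs  : t ⇛ t' → u ⇛ u' → abs t u ⇛ abs t' u'
    app  : t ⇛ t' → u ⇛ u' → app t u ⇛ app t' u'
    prod : t ⇛ t' → u ⇛ u' → prod t u ⇛ prod t' u'
    beta : ∀ {U b b' a a'} → b ⇛ b' → a ⇛ a' → app (abs U b) a ⇛ b' [ a' ]

  par-refl : ∀ t → t ⇛ t
  par-refl (srt s)    = srt
  par-refl (var x)    = var
  par-refl (sym f)    = sym
  par-refl (abs t u)  = abs (par-refl t) (par-refl u)
  par-refl (app t u)  = app (par-refl t) (par-refl u)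
  par-refl (prod t u) = prod (par-refl t) (par-refl u)

  par-rename : ∀ ρ → t ⇛ t' → rename ρ t ⇛ rename ρ t'
  par-rename ρ srt        = srt
  par-rename ρ var        = var
  par-rename ρ sym        = sym
  par-rename ρ (abs p q)  = abs (par-rename ρ p) (par-rename (⇑ ρ) q)
  par-rename ρ (app p q)  = app (par-rename ρ p) (par-rename ρ q)
  par-rename ρ (prod p q) = prod (par-rename ρ p) (par-rename (⇑ ρ) q)
  par-rename ρ (beta {b' = b'} {a' = a'} p q) =
    ≡.subst (_ ⇛_) (≡.sym (rename-[] ρ b' a')) (beta (par-rename (⇑ ρ) p) (par-rename ρ q))

  _⇛ₛ_ : Rel (ℕ → Term F)
  σ ⇛ₛ σ' = ∀ x → σ x ⇛ σ' x

  par-exts : σ ⇛ₛ σ' → exts σ ⇛ₛ exts σ'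
  par-exts h zero    = var
  par-exts h (suc x) = par-rename suc (h x)

  par-subst : σ ⇛ₛ σ' → t ⇛ t' → subst σ t ⇛ subst σ' t'
  par-subst h srt        = srt
  par-subst h (var {x})  = h x
  par-subst h sym        = sym
  par-subst h (abs p q)  = abs (par-subst h p) (par-subst (par-exts h) q)
  par-subst h (app p q)  = app (par-subst h p) (par-subst h q)
  par-subst h (prod p q) = prod (par-subst h p) (par-subst (par-exts h) q)
  par-subst {σ' = σ'} h (beta {b' = b'} {a' = a'} p q) =
    ≡.subst (_ ⇛_) (≡.sym (subst-[] σ' b' a')) (beta (par-subst (par-exts h) p) (par-subst h q))

  par-[] : b ⇛ b' → a ⇛ a' → b [ a ] ⇛ b' [ a' ]
  par-[] p q = par-subst par-subst₀ p
    where
    par-subst₀ : subst₀ _ ⇛ₛ subst₀ _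
    par-subst₀ zero    = q
    par-subst₀ (suc x) = var

  develop : Term F → Term F
  develop (srt s)             = srt s
  develop (var x)             = var x
  develop (sym f)             = sym f
  develop (abs t u)           = abs (develop t) (develop u)
  develop (app (abs U b) a)   = develop b [ develop a ]
  develop (app t a)           = app (develop t) (develop a)
  develop (prod t u)          = prod (develop t) (develop u)

  par-develop : t ⇛ u → u ⇛ develop t
  par-develop srt                        = srt
  par-develop var                        = var
  par-develop sym                        = sym
  par-develop (abs p q)                  = abs (par-develop p) (par-develop q)
  par-develop (app (abs p₁ p₂) q)        = beta (par-develop p₂) (par-develop q)
  par-develop (app p@srt q)              = app (par-develop p) (par-develop q)
  par-develop (app p@var q)              = app (par-develop p) (par-develop q)
  par-develop (app p@sym q)              = app (par-develop p) (par-develop q)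
  par-develop (app p@(app _ _) q)        = app (par-develop p) (par-develop q)
  par-develop (app p@(prod _ _) q)       = app (par-develop p) (par-develop q)
  par-develop (app p@(beta _ _) q)       = app (par-develop p) (par-develop q)
  par-develop (prod p q)                 = prod (par-develop p) (par-develop q)
  par-develop (beta p q)                 = par-[] (par-develop p) (par-develop q)

  par-diamond : t ⇛ u → t ⇛ v → ∃[ w ] (u ⇛ w × v ⇛ w)
  par-diamond {t} p q = develop t , par-develop p , par-develop q

  module _ {S : Rel (Term F)} where

    absL* : Star (Ctx S) t t' → Star (Ctx S) (abs t u) (abs t' u)
    absL* = gmap _ absL

    absR* : Star (Ctx S) u u' → Star (Ctx S) (abs t u) (abs t u')
    absR* = gmap _ absR

    appL* : Star (Ctx S) t t' → Star (Ctx S) (app t u) (app t' u)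
    appL* = gmap _ appL

    appR* : Star (Ctx S) u u' → Star (Ctx S) (app t u) (app t u')
    appR* = gmap _ appR

    prodL* : Star (Ctx S) t t' → Star (Ctx S) (prod t u) (prod t' u)
    prodL* = gmap _ prodL

    prodR* : Star (Ctx S) u u' → Star (Ctx S) (prod t u) (prod t u')
    prodR* = gmap _ prodR

  beta⊆par : BetaStep ⇒ _⇛_
  beta⊆par (root (beta U v u)) = beta (par-refl v) (par-refl u)
  beta⊆par (absL s)            = abs (beta⊆par s) (par-refl _)
  beta⊆par (absR s)            = abs (par-refl _) (beta⊆par s)
  beta⊆par (appL s)            = app (beta⊆par s) (par-refl _)
  beta⊆par (appR s)            = app (par-refl _) (beta⊆par s)
  beta⊆par (prodL s)           = prod (beta⊆par s) (par-refl _)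
  beta⊆par (prodR s)           = prod (par-refl _) (beta⊆par s)

  par⊆beta* : _⇛_ ⇒ Star (BetaStep {F})
  par⊆beta* srt        = ε
  par⊆beta* var        = ε
  par⊆beta* sym        = ε
  par⊆beta* (abs p q)  = absL* (par⊆beta* p) ◅◅ absR* (par⊆beta* q)
  par⊆beta* (app p q)  = appL* (par⊆beta* p) ◅◅ appR* (par⊆beta* q)
  par⊆beta* (prod p q) = prodL* (par⊆beta* p) ◅◅ prodR* (par⊆beta* q)
  par⊆beta* (beta {U = U} {b' = b'} {a' = a'} p q) =
    appL* (absR* (par⊆beta* p)) ◅◅ appR* (par⊆beta* q) ◅◅ return (root (beta U b' a'))

  -- Parallel reducts of instances of linear algebraic terms

  occ-self : ∀ x → occ {F} x (var x) ≡ 1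
  occ-self x with x ≟ x
  ... | yes _   = refl
  ... | no  x≢x = ⊥-elim (x≢x refl)

  exts-cong-occ : ∀ (u : Term F) → (∀ y → occ (suc y) u ≢ 0 → σ y ≡ τ y) →
                  ∀ y → occ y u ≢ 0 → exts σ y ≡ exts τ y
  exts-cong-occ u h zero    _  = refl
  exts-cong-occ u h (suc y) ne = cong (rename suc) (h y ne)

  subst-cong-occ : ∀ t → (∀ y → occ y t ≢ 0 → σ y ≡ τ y) → subst σ t ≡ subst τ t
  subst-cong-occ (srt s)    h = refl
  subst-cong-occ (var x)    h = h x (λ occ≡0 → 1≢0 (≡.trans (≡.sym (occ-self x)) occ≡0))
    where
    1≢0 : 1 ≢ 0
    1≢0 ()
  subst-cong-occ (sym f)    h = refl
  subst-cong-occ (abs t u)  h = cong₂ abs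
    (subst-cong-occ t (λ y → h y ∘ m≢0⇒m+n≢0 _))
    (subst-cong-occ u (exts-cong-occ u (λ y → h y ∘ n≢0⇒m+n≢0 (occ y t))))
  subst-cong-occ (app t u)  h = cong₂ app
    (subst-cong-occ t (λ y → h y ∘ m≢0⇒m+n≢0 _))
    (subst-cong-occ u (λ y → h y ∘ n≢0⇒m+n≢0 (occ y t)))
  subst-cong-occ (prod t u) h = cong₂ prod
    (subst-cong-occ t (λ y → h y ∘ m≢0⇒m+n≢0 _))
    (subst-cong-occ u (exts-cong-occ u (λ y → h y ∘ n≢0⇒m+n≢0 (occ y t))))

  linear-appˡ : ∀ {t u : Term F} → LinearTerm (app t u) → LinearTerm t
  linear-appˡ {t} {u} lin x = ≤-trans (m≤m+n (occ x t) (occ x u)) (lin x)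

  linear-appʳ : ∀ {t u : Term F} → LinearTerm (app t u) → LinearTerm u
  linear-appʳ {t} {u} lin x = ≤-trans (m≤n+m (occ x u) (occ x t)) (lin x)

  linear-app-disjoint : ∀ {t u : Term F} → LinearTerm (app t u) → ∀ {y} → occ y u ≢ 0 → occ y t ≡ 0
  linear-app-disjoint {t} lin {y} = m+n≤1∧n≢0⇒m≡0 (occ y t) (lin y)

  update : (ℕ → Term F) → ℕ → Term F → ℕ → Term F
  update σ x u y with y ≟ x
  ... | yes _ = u
  ... | no  _ = σ y

  update-self : ∀ σ x u → update σ x u x ≡ u
  update-self σ x u with x ≟ x
  ... | yes _   = refl
  ... | no  x≢x = ⊥-elim (x≢x refl)

  par-update : ∀ {x} → σ x ⇛ u → σ ⇛ₛ update σ x u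
  par-update {σ = σ} {x = x} p y with y ≟ x
  ... | yes refl = p
  ... | no  _    = par-refl (σ y)

  merge : Term F → (ℕ → Term F) → (ℕ → Term F) → ℕ → Term F
  merge h σ₁ σ₂ y with occ y h ≟ 0
  ... | yes _ = σ₂ y
  ... | no  _ = σ₁ y

  merge-occ : ∀ h σ₁ σ₂ {y} → occ y h ≢ 0 → merge h σ₁ σ₂ y ≡ σ₁ y
  merge-occ h σ₁ σ₂ {y} occ≢0 with occ y h ≟ 0
  ... | yes occ≡0 = ⊥-elim (occ≢0 occ≡0)
  ... | no  _     = refl

  merge-nocc : ∀ h σ₁ σ₂ {y} → occ y h ≡ 0 → merge h σ₁ σ₂ y ≡ σ₂ y
  merge-nocc h σ₁ σ₂ {y} occ≡0 with occ y h ≟ 0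
  ... | yes _     = refl
  ... | no  occ≢0 = ⊥-elim (occ≢0 occ≡0)

  par-merge : ∀ h {σ₁ σ₂} → σ ⇛ₛ σ₁ → σ ⇛ₛ σ₂ → σ ⇛ₛ merge h σ₁ σ₂
  par-merge h p₁ p₂ y with occ y h ≟ 0
  ... | yes _ = p₂ y
  ... | no  _ = p₁ y

  spine-subst≢abs : ∀ {α f h n} → AlgSpine α f h n → subst σ h ≢ abs U b
  spine-subst≢abs sym       ()
  spine-subst≢abs (app _ _) ()

  par-app-inv : ∀ {s} → (∀ {U b} → s ≢ abs U b) → app s a ⇛ u →
                ∃[ s' ] ∃[ a' ] (u ≡ app s' a' × s ⇛ s' × a ⇛ a')
  par-app-inv s≢abs (app p q)  = _ , _ , refl , p , q
  par-app-inv s≢abs (beta p q) = ⊥-elim (s≢abs refl)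

  mutual
    par-instance : ∀ {α l} → Algebraic α l → LinearTerm l → subst σ l ⇛ u →
                   ∃[ σ' ] (u ≡ subst σ' l × σ ⇛ₛ σ')
    par-instance {σ = σ} {u} (var x) _ p = update σ x u , ≡.sym (update-self σ x u) , par-update p
    par-instance (fun sp) lin p = par-spine-instance sp lin p

    par-spine-instance : ∀ {α f h n} → AlgSpine α f h n → LinearTerm h → subst σ h ⇛ u →
                         ∃[ σ' ] (u ≡ subst σ' h × σ ⇛ₛ σ')
    par-spine-instance {σ = σ} sym _ sym = σ , refl , par-refl ∘ σ
    par-spine-instance (app {h} {a} sp al) lin p with par-app-inv (spine-subst≢abs sp) p
    ... | _ , _ , refl , p₁ , p₂
        with par-spine-instance sp (linear-appˡ {h} {a} lin) p₁ | par-instance al (linear-appʳ {h} {a} lin) p₂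
    ... | σ₁ , refl , σ⇛σ₁ | σ₂ , refl , σ⇛σ₂ =
      merge h σ₁ σ₂ , cong₂ app (≡.sym on-head) (≡.sym on-arg) , par-merge h σ⇛σ₁ σ⇛σ₂
      where
      on-head : subst (merge h σ₁ σ₂) h ≡ subst σ₁ h
      on-head = subst-cong-occ h (λ _ → merge-occ h σ₁ σ₂)
      on-arg : subst (merge h σ₁ σ₂) a ≡ subst σ₂ a
      on-arg = subst-cong-occ a (λ _ → merge-nocc h σ₁ σ₂ ∘ linear-app-disjoint {h} {a} lin)

  -- Rewriting commutes with parallel β-reduction

  module _ {X : Rel (Term F)} where

    rstep-subst : ∀ σ → RStep X t t' → RStep X (subst σ t) (subst σ t')
    rstep-subst σ (root (inst {l} {r} τ x)) =
      root (≡.subst₂ (RootStep X) (≡.sym (subst-subst σ τ l)) (≡.sym (subst-subst σ τ r)) (inst _ x))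
    rstep-subst σ (absL s)  = absL (rstep-subst σ s)
    rstep-subst σ (absR s)  = absR (rstep-subst (exts σ) s)
    rstep-subst σ (appL s)  = appL (rstep-subst σ s)
    rstep-subst σ (appR s)  = appR (rstep-subst σ s)
    rstep-subst σ (prodL s) = prodL (rstep-subst σ s)
    rstep-subst σ (prodR s) = prodR (rstep-subst (exts σ) s)

    rstep*-subst : ∀ σ → Star (RStep X) t t' → Star (RStep X) (subst σ t) (subst σ t')
    rstep*-subst σ = gmap (subst σ) (rstep-subst σ)

    rstep*-rename : ∀ ρ → Star (RStep X) t t' → Star (RStep X) (rename ρ t) (rename ρ t')
    rstep*-rename {t} {t'} ρ steps =
      ≡.subst₂ (Star (RStep X)) (≡.sym (rename-as-subst ρ t)) (≡.sym (rename-as-subst ρ t'))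
        (rstep*-subst (ren ρ) steps)

    rstep*-exts : (∀ x → Star (RStep X) (σ x) (σ' x)) → ∀ x → Star (RStep X) (exts σ x) (exts σ' x)
    rstep*-exts h zero    = ε
    rstep*-exts h (suc x) = rstep*-rename suc (h x)

    rstep*-substs : (∀ x → Star (RStep X) (σ x) (σ' x)) →
                    ∀ t → Star (RStep X) (subst σ t) (subst σ' t)
    rstep*-substs h (srt s)    = ε
    rstep*-substs h (var x)    = h x
    rstep*-substs h (sym f)    = ε
    rstep*-substs h (abs t u)  = absL* (rstep*-substs h t) ◅◅ absR* (rstep*-substs (rstep*-exts h) u)
    rstep*-substs h (app t u)  = appL* (rstep*-substs h t) ◅◅ appR* (rstep*-substs h u)
    rstep*-substs h (prod t u) = prodL* (rstep*-substs h t) ◅◅ prodR* (rstep*-substs (rstep*-exts h) u)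

  LinearNonVarLhs : (F → ℕ) → Rel (Term F) → Set
  LinearNonVarLhs α X = ∀ {l r} → X l r → LinearTerm l × ∃[ f ] AlgSpine α f l (α f)

  module _ {α : F → ℕ} {X : Rel (Term F)} (lhs : LinearNonVarLhs α X) where

    rootStep-redex≢abs : ∀ {s s'} → RootStep X s s' → s ≢ abs U b
    rootStep-redex≢abs (inst σ x) with lhs x
    ... | _ , _ , sp = spine-subst≢abs sp

    par-rstep-commute : RStep X t t' → t ⇛ u → ∃[ w ] (t' ⇛ w × Star (RStep X) u w)
    par-rstep-commute (root (inst {r = r} σ x)) p with lhs x
    ... | lin , _ , sp with par-spine-instance sp lin p
    ... | σ' , refl , σ⇛σ' = subst σ' r , par-subst σ⇛σ' (par-refl r) , return (root (inst σ' x))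
    par-rstep-commute (absL s) (abs p q) with par-rstep-commute s p
    ... | w , p' , s' = abs w _ , abs p' q , absL* s'
    par-rstep-commute (absR s) (abs p q) with par-rstep-commute s q
    ... | w , q' , s' = abs _ w , abs p q' , absR* s'
    par-rstep-commute (appL s) (app p q) with par-rstep-commute s p
    ... | w , p' , s' = app w _ , app p' q , appL* s'
    par-rstep-commute (appR s) (app p q) with par-rstep-commute s q
    ... | w , q' , s' = app _ w , app p q' , appR* s'
    par-rstep-commute (prodL s) (prod p q) with par-rstep-commute s p
    ... | w , p' , s' = prod w _ , prod p' q , prodL* s'
    par-rstep-commute (prodR s) (prod p q) with par-rstep-commute s q
    ... | w , q' , s' = prod _ w , prod p q' , prodR* s'
    par-rstep-commute (appL (root step)) (beta p q) = ⊥-elim (rootStep-redex≢abs step refl)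
    par-rstep-commute (appL (absL s)) (beta p q) = _ , beta p q , ε
    par-rstep-commute (appL (absR s)) (beta {a' = a'} p q) with par-rstep-commute s p
    ... | w , p' , s' = w [ a' ] , beta p' q , rstep*-subst (subst₀ a') s'
    par-rstep-commute (appR s) (beta {b' = b'} {a' = a'} p q) with par-rstep-commute s q
    ... | w , q' , s' = b' [ w ] , beta p q' , rstep*-substs reduce-subst₀ b'
      where
      reduce-subst₀ : ∀ x → Star (RStep X) (subst₀ a' x) (subst₀ w x)
      reduce-subst₀ zero    = s'
      reduce-subst₀ (suc x) = ε

    par-rstep*-commute : Star (RStep X) t t' → t ⇛ u → ∃[ w ] (t' ⇛ w × Star (RStep X) u w)
    par-rstep*-commute ε p = _ , p , ε
    par-rstep*-commute (s ◅ ss) p with par-rstep-commute s p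
    ... | w₁ , p₁ , s₁ with par-rstep*-commute ss p₁
    ... | w , p' , s' = w , p' , s₁ ◅◅ s'

  rstep-sym : ∀ {X : Rel (Term F)} → (∀ {l r} → X l r → X r l) → RStep X t u → RStep X u t
  rstep-sym X-sym (root (inst σ x)) = root (inst σ (X-sym x))
  rstep-sym X-sym (absL s)          = absL (rstep-sym X-sym s)
  rstep-sym X-sym (absR s)          = absR (rstep-sym X-sym s)
  rstep-sym X-sym (appL s)          = appL (rstep-sym X-sym s)
  rstep-sym X-sym (appR s)          = appR (rstep-sym X-sym s)
  rstep-sym X-sym (prodL s)         = prodL (rstep-sym X-sym s)
  rstep-sym X-sym (prodR s)         = prodR (rstep-sym X-sym s)

  Equiv-isEquivalence : ∀ {E : Rel (Term F)} → (∀ {l r} → E l r → E r l) → IsEquivalence (Equiv E)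
  Equiv-isEquivalence E-sym = record
    { refl  = ε
    ; sym   = reverse (rstep-sym E-sym)
    ; trans = _◅◅_
    }

  algebraic-nonVar⇒spine : ∀ {α : F → ℕ} {l} → Algebraic α l → ¬ IsVar l → ∃[ f ] AlgSpine α f l (α f)
  algebraic-nonVar⇒spine (var x) ¬var = ⊥-elim (¬var (x , refl))
  algebraic-nonVar⇒spine (fun sp) _   = _ , sp

  headed⇒nonVar : HeadedBySymbol t → ¬ IsVar t
  headed⇒nonVar (_ , ()) (_ , refl)

  equation-lhs : ∀ {α : F → ℕ} {E} → IsEquationSet α E → LinearEqs E → LinearNonVarLhs α E
  equation-lhs (_ , shape) linear e with shape e
  ... | alg , _ , headed , _ = proj₁ (linear e) , algebraic-nonVar⇒spine alg (headed⇒nonVar headed)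

  rule-lhs : ∀ {α : F → ℕ} {R} → IsRuleSet α R → LeftLinear R → LinearNonVarLhs α R
  rule-lhs shape leftLinear r with shape r
  ... | alg , nonVar , _ = leftLinear r , algebraic-nonVar⇒spine alg nonVar

  module ParOrRewrite {α : F → ℕ} {E R : Rel (Term F)} (E-sym : ∀ {l r} → E l r → E r l)
                      (E-lhs : LinearNonVarLhs α E) (R-lhs : LinearNonVarLhs α R) where

    open ModuloEquivalence (Equiv-isEquivalence {E = E} E-sym)

    ParOrRewrites : Rel (Term F)
    ParOrRewrites = _⇛_ ∪ Star (RStep R)

    par-rewrites-joinable : t ⇛ u → Equiv E t t' → Star (RStep R) t' v →
                            Joinable (Equiv E ⨾ ParOrRewrites) u v
    par-rewrites-joinable p t∼t' r with par-rstep*-commute E-lhs t∼t' p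
    ... | u₁ , t'⇛u₁ , u∼u₁ with par-rstep*-commute R-lhs r t'⇛u₁
    ... | w , v⇛w , u₁→w = w , w , (_ , u∼u₁ , inj₂ u₁→w) , (_ , ε , inj₁ v⇛w) , ε

    parOrRewrites-diamondMod : ConfluentModulo E (RStep R) → DiamondMod ParOrRewrites
    parOrRewrites-diamondMod _ (inj₁ p) t∼t' (inj₁ q) with par-rstep*-commute E-lhs t∼t' p
    ... | u₁ , t'⇛u₁ , u∼u₁ with par-diamond t'⇛u₁ q
    ... | w , u₁⇛w , v⇛w = w , w , (_ , u∼u₁ , inj₁ u₁⇛w) , (_ , ε , inj₁ v⇛w) , ε
    parOrRewrites-diamondMod _ (inj₁ p) t∼t' (inj₂ r) = par-rewrites-joinable p t∼t' r
    parOrRewrites-diamondMod _ (inj₂ r) t∼t' (inj₁ p) =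
      joinable-sym {Equiv E ⨾ ParOrRewrites} (par-rewrites-joinable p (∼-sym t∼t') r)
    parOrRewrites-diamondMod R-confluent (inj₂ r) t∼t' (inj₂ r') with R-confluent r t∼t' r'
    ... | u' , v' , uu' , vv' , u'∼v' = u' , v' , (_ , ε , inj₂ uu') , (_ , ε , inj₂ vv') , u'∼v'

    bigStep⊆∼⨾parOrRewrites : BigStep E R ⇒ (Equiv E ⨾ ParOrRewrites)
    bigStep⊆∼⨾parOrRewrites (inj₁ s)              = _ , ε , inj₁ (beta⊆par s)
    bigStep⊆∼⨾parOrRewrites (inj₂ (_ , t∼t' , r)) = _ , t∼t' , inj₂ (return r)

    par⊆bigStep* : _⇛_ ⇒ Star (BigStep E R)
    par⊆bigStep* = map inj₁ ∘ par⊆beta*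

    parOrRewrites⊆bigStep* : ParOrRewrites ⇒ Star (BigStep E R)
    parOrRewrites⊆bigStep* (inj₁ p)  = par⊆bigStep* p
    parOrRewrites⊆bigStep* (inj₂ rs) = map (λ r → inj₂ (_ , ε , r)) rs

    equiv-postpone : Equiv E t t' → Star (BigStep E R) t' v → (Star (BigStep E R) ⨾ Equiv E) t v
    equiv-postpone t∼s ε = _ , ε , t∼s
    equiv-postpone t∼s (inj₁ β ◅ steps) with par-rstep*-commute E-lhs (∼-sym t∼s) (beta⊆par β)
    ... | x , t⇛x , s₁∼x with equiv-postpone (∼-sym s₁∼x) steps
    ... | a , xa , a∼v = a , par⊆bigStep* t⇛x ◅◅ xa , a∼v
    equiv-postpone t∼s (inj₂ (_ , s∼s' , r) ◅ steps) = _ , inj₂ (_ , t∼s ◅◅ s∼s' , r) ◅ steps , ε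

theorem6 : {F : Set} (α : F → ℕ) (E R : Rel (Term F)) →
    IsEquationSet α E → IsRuleSet α R →
    LinearEqs E → LeftLinear R →
    ConfluentModulo E (RStep R) →
    ConfluentModulo E (BigStep E R)
theorem6 α E R isE isR linE linR R-confluent =
  confluentMod-transfer bigStep⊆∼⨾parOrRewrites
    (λ { (s , t∼s , x) → s , t∼s , parOrRewrites⊆bigStep* x })
    equiv-postpone
    (diamondMod⇒confluentMod (parOrRewrites-diamondMod R-confluent))
  where
  open ModuloEquivalence (Equiv-isEquivalence (proj₁ isE))
  open ParOrRewrite (proj₁ isE) (equation-lhs isE linE) (rule-lhs isR linR)
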